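{- Let $c \geq 2$ and $n \geq 4$ be integers. Every collection of directed graphs $G_1, \ldots, G_c$ on a common set of $n$ vertices containing no rainbow $S_{1,1}$ satisfies \[\min_{1\leq i \leq c} e(G_i) \leq \left\lfloor\frac{n^2}{4}\right\rfloor.\] Moreover, this bound is sharp: for all such $c,n$ there is a collection with no rainbow $S_{1,1}$ attaining equality.
   Context: Each $G_i$ is a directed graph without loops or multiple edges on the common vertex set $V$ (for distinct $u,v$, the edges $uv$ and $vu$ may both be present); $e(G_i)$ denotes the number of directed edges of $G_i$. Think of $G_i$ as the edges of color $i$. $S_{1,1}$ is the directed path with two edges $x\to y\to z$ on three distinct vertices. The collection contains a rainbow $S_{1,1}$ if there are distinct vertices $x,y,z\in V$ and distinct indices $i\neq j$ with $xy\in E(G_i)$ and $yz\in E(G_j)$. -}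

module Defs where

open import Data.Nat using (ℕ; _*_; _/_; _≤_)
open import Data.Bool using (Bool; true; false)
open import Data.Fin using (Fin)
open import Data.List using (List; length; filter; cartesianProduct; allFin)
open import Data.Product using (_×_; _,_; ∃-syntax; proj₁; proj₂)
open import Relation.Binary.PropositionalEquality using (_≡_; _≢_)
open import Data.Bool.Properties using (_≟_)

-- A directed graph on vertex set Fin n, given by its adjacency relation
-- (Bool-valued, so edges are decidable and countable); G u v ≡ true means u → v. Multiple edges are impossible by construction;
-- both uv and vu may be present.
record Digraph (n : ℕ) : Set where
  field
    adj     : Fin n → Fin n → Bool
    noLoops : ∀ v → adj v v ≡ false
open Digraph public

e : ∀ {n} → Digraph n → ℕ
e {n} G = length (filter (λ p → adj G (proj₁ p) (proj₂ p) ≟ true)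
                         (cartesianProduct (allFin n) (allFin n)))

Collection : ℕ → ℕ → Set
Collection c n = Fin c → Digraph n

HasRainbowS11 : ∀ {c n} → Collection c n → Set
HasRainbowS11 {c} {n} G =
  ∃[ x ] ∃[ y ] ∃[ z ] ∃[ i ] ∃[ j ]
    (x ≢ y × y ≢ z × x ≢ z × i ≢ j ×
     adj (G i) x y ≡ true × adj (G j) y z ≡ true)

quarterSq : ℕ → ℕ
quarterSq n = (n * n) / 4

-- Let G, H be two colours with no rainbow path in either order. A G-edge u → v either
-- ends in a vertex of S = in(G) ∩ out(H), whose G-in-neighbours all coincide with any of its
-- H-out-neighbours (so its G-in-degree is at most 1), or runs from B = out(G) ∖ in(H) to
-- A = in(G) ∖ out(H); hence e(G) ≤ |B|·|A| + |S|. Reversing every edge gives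
-- e(H) ≤ |in(H) ∖ out(G)|·|out(H) ∖ in(G)| + |S|.
-- Now A, out(H) ∖ in(G) and S are pairwise disjoint, as are B and in(H) ∖ out(G), so by AM–GM
-- the smaller product is at most (n − |S|)·n/4, and the smaller of e(G), e(H) is at most n²/4
-- as n ≥ 4. Orienting every edge from the lower half of the vertices to the upper half, in
-- every colour, attains the bound without any directed path of length two.

module Submission where

open import Defs
open import Data.Nat using (ℕ; zero; suc; _+_; _*_; _⊓_; _≤_; _<ᵇ_; _/_; _≤?_; z≤n; s≤s; ⌊_/2⌋; ⌈_/2⌉)
open import Data.Nat.Properties hiding (_≟_)
open import Data.Nat.DivMod using (m*n/n≡m; /-monoˡ-≤; +-distrib-/-∣ʳ)
open import Data.Nat.Divisibility using (divides-refl)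
open import Data.Nat.Tactic.RingSolver using (solve-∀)
open import Data.Fin using (Fin; zero; suc; toℕ; punchIn)
open import Data.Fin.Properties using (any?; punchInᵢ≢i) renaming (_≟_ to _≟ᶠ_)
open import Data.Bool using (Bool; true; false; _∧_; not)
open import Data.Bool.Properties using (_≟_; ∧-conicalˡ; ∧-conicalʳ; ∧-inverseʳ; ∧-comm; ¬-not)
open import Data.List using (length; filter; tabulate; cartesianProduct; map; _++_)
open import Data.List.Properties using (filter-++; length-++; map-tabulate)
open import Data.Product using (_×_; _,_; proj₁; proj₂; ∃-syntax; Σ-syntax)
open import Data.Sum as Sum using (_⊎_; inj₁; inj₂; [_,_]′)
open import Data.Empty using (⊥)
open import Function using (_∘_; id)
open import Relation.Binary.PropositionalEquality
  using (_≡_; _≢_; refl; sym; trans; cong; cong₂; subst; subst₂; module ≡-Reasoning)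
open import Relation.Nullary using (¬_; does; yes; no; contradiction)
open import Relation.Nullary.Decidable using (dec-true)
open import Algebra.Properties.Semiring.Sum +-*-semiring
  using (sum; sum-syntax; sum-cong-≗; sum-remove; sum-replicate-zero; ∑-distrib-+; ∑-comm;
         *-distribˡ-sum; *-distribʳ-sum)

⟦_⟧ : Bool → ℕ
⟦ true ⟧  = 1
⟦ false ⟧ = 0

⟦⟧≤1 : ∀ b → ⟦ b ⟧ ≤ 1
⟦⟧≤1 true  = s≤s z≤n
⟦⟧≤1 false = z≤n

⟦∧⟧ : ∀ a b → ⟦ a ∧ b ⟧ ≡ ⟦ a ⟧ * ⟦ b ⟧
⟦∧⟧ true  b = sym (*-identityˡ ⟦ b ⟧)
⟦∧⟧ false b = refl

∣_∣ : ∀ {n} → (Fin n → Bool) → ℕ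
∣_∣ {n} p = ∑[ i < n ] ⟦ p i ⟧

_∩_ _∖_ : ∀ {n} → (Fin n → Bool) → (Fin n → Bool) → Fin n → Bool
(p ∩ q) i = p i ∧ q i
(p ∖ q) i = p i ∧ not (q i)

∑-mono-≤ : ∀ {n} {f g : Fin n → ℕ} → (∀ i → f i ≤ g i) → sum f ≤ sum g
∑-mono-≤ {zero}  f≤g = z≤n
∑-mono-≤ {suc n} f≤g = +-mono-≤ (f≤g zero) (∑-mono-≤ (f≤g ∘ suc))

∑[≤1]≤n : ∀ {n} {f : Fin n → ℕ} → (∀ i → f i ≤ 1) → sum f ≤ n
∑[≤1]≤n {zero}  f≤1 = z≤n
∑[≤1]≤n {suc n} f≤1 = +-mono-≤ (f≤1 zero) (∑[≤1]≤n (f≤1 ∘ suc))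

∑-supported-at : ∀ {n} (f : Fin n → ℕ) (j : Fin n) →
                 (∀ i → i ≢ j → f i ≡ 0) → sum f ≡ f j
∑-supported-at {suc n} f j f≡0 = begin
  sum f                                ≡⟨ sum-remove {i = j} f ⟩
  f j + ∑[ k < n ] f (punchIn j k)     ≡⟨ cong (f j +_) ∑-punchIn≡0 ⟩
  f j + 0                              ≡⟨ +-identityʳ (f j) ⟩
  f j                                  ∎
  where
  open ≡-Reasoning
  ∑-punchIn≡0 : ∑[ k < n ] f (punchIn j k) ≡ 0
  ∑-punchIn≡0 = trans (sum-cong-≗ (λ k → f≡0 (punchIn j k) (punchInᵢ≢i j k)))
                      (sum-replicate-zero n)

∑∑-* : ∀ {m n} (f : Fin m → ℕ) (g : Fin n → ℕ) →
       ∑[ i < m ] ∑[ j < n ] (f i * g j) ≡ sum f * sum g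
∑∑-* f g = trans (sum-cong-≗ (λ i → sym (*-distribˡ-sum (f i) g)))
                 (sym (*-distribʳ-sum (sum g) f))

∑∑-distrib-+ : ∀ {m n} (f g : Fin m → Fin n → ℕ) →
  ∑[ i < m ] ∑[ j < n ] (f i j + g i j) ≡ ∑[ i < m ] ∑[ j < n ] f i j + ∑[ i < m ] ∑[ j < n ] g i j
∑∑-distrib-+ {n = n} f g = trans (sum-cong-≗ (λ i → ∑-distrib-+ (f i) (g i)))
                                 (∑-distrib-+ (λ i → ∑[ j < n ] f i j) (λ i → ∑[ j < n ] g i j))

∣∩∣-comm : ∀ {n} (p q : Fin n → Bool) → ∣ p ∩ q ∣ ≡ ∣ q ∩ p ∣
∣∩∣-comm p q = sum-cong-≗ (λ i → cong ⟦_⟧ (∧-comm (p i) (q i)))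

∣∖∣+∣∖∣+∣∩∣≤n : ∀ {n} (p q : Fin n → Bool) → ∣ p ∖ q ∣ + ∣ q ∖ p ∣ + ∣ p ∩ q ∣ ≤ n
∣∖∣+∣∖∣+∣∩∣≤n {n} p q = begin
  ∣ p ∖ q ∣ + ∣ q ∖ p ∣ + ∣ p ∩ q ∣
    ≡⟨ cong (_+ ∣ p ∩ q ∣) (∑-distrib-+ (⟦_⟧ ∘ (p ∖ q)) (⟦_⟧ ∘ (q ∖ p))) ⟨
  ∑[ i < n ] (⟦ (p ∖ q) i ⟧ + ⟦ (q ∖ p) i ⟧) + ∣ p ∩ q ∣
    ≡⟨ ∑-distrib-+ _ (⟦_⟧ ∘ (p ∩ q)) ⟨
  ∑[ i < n ] (⟦ (p ∖ q) i ⟧ + ⟦ (q ∖ p) i ⟧ + ⟦ (p ∩ q) i ⟧)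
    ≤⟨ ∑[≤1]≤n (λ i → pointwise (p i) (q i)) ⟩
  n ∎
  where
  open ≤-Reasoning
  pointwise : ∀ a b → ⟦ a ∧ not b ⟧ + ⟦ b ∧ not a ⟧ + ⟦ a ∧ b ⟧ ≤ 1
  pointwise true  true  = s≤s z≤n
  pointwise true  false = s≤s z≤n
  pointwise false true  = s≤s z≤n
  pointwise false false = z≤n

∣p∣+∣not∘p∣≡n : ∀ {n} (p : Fin n → Bool) → ∣ p ∣ + ∣ not ∘ p ∣ ≡ n
∣p∣+∣not∘p∣≡n {zero}  p = refl
∣p∣+∣not∘p∣≡n {suc n} p with p zero
... | true  = cong suc (∣p∣+∣not∘p∣≡n (p ∘ suc))
... | false = trans (+-suc ∣ p ∘ suc ∣ ∣ not ∘ p ∘ suc ∣) (cong suc (∣p∣+∣not∘p∣≡n (p ∘ suc)))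

length-filter-tabulate : ∀ {A : Set} {k} (F : A → Bool) (g : Fin k → A) →
  length (filter (λ x → F x ≟ true) (tabulate g)) ≡ ∑[ j < k ] ⟦ F (g j) ⟧
length-filter-tabulate {k = zero}  F g = refl
length-filter-tabulate {k = suc k} F g with F (g zero)
... | true  = cong suc (length-filter-tabulate F (g ∘ suc))
... | false = length-filter-tabulate F (g ∘ suc)

length-filter-cartesianProduct : ∀ {A B : Set} {m k}
  (F : A × B → Bool) (f : Fin m → A) (g : Fin k → B) →
  length (filter (λ p → F p ≟ true) (cartesianProduct (tabulate f) (tabulate g)))
    ≡ ∑[ i < m ] ∑[ j < k ] ⟦ F (f i , g j) ⟧
length-filter-cartesianProduct {m = zero}  F f g = refl
length-filter-cartesianProduct {m = suc m} F f g = begin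
  length (filter P? (row ++ rest))               ≡⟨ cong length (filter-++ P? row rest) ⟩
  length (filter P? row ++ filter P? rest)       ≡⟨ length-++ (filter P? row) ⟩
  length (filter P? row) + length (filter P? rest)
    ≡⟨ cong₂ _+_ (trans (cong (length ∘ filter P?) (map-tabulate g (f zero ,_)))
                        (length-filter-tabulate F ((f zero ,_) ∘ g)))
                 (length-filter-cartesianProduct F (f ∘ suc) g) ⟩
  ∑[ j < _ ] ⟦ F (f zero , g j) ⟧ + ∑[ i < m ] ∑[ j < _ ] ⟦ F (f (suc i) , g j) ⟧ ∎
  where
  open ≡-Reasoning
  P? = λ p → F p ≟ true
  row  = map (f zero ,_) (tabulate g)
  rest = cartesianProduct (tabulate (f ∘ suc)) (tabulate g)

e≡∑∑ : ∀ {n} (G : Digraph n) → e G ≡ ∑[ u < n ] ∑[ v < n ] ⟦ adj G u v ⟧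
e≡∑∑ G = length-filter-cartesianProduct (λ p → adj G (proj₁ p) (proj₂ p)) id id

transpose : ∀ {n} → Digraph n → Digraph n
transpose G = record { adj = λ u v → adj G v u ; noLoops = noLoops G }

e-transpose : ∀ {n} (G : Digraph n) → e (transpose G) ≡ e G
e-transpose G = trans (e≡∑∑ (transpose G)) (trans (∑-comm (λ u v → ⟦ adj G v u ⟧)) (sym (e≡∑∑ G)))

adj⇒≢ : ∀ {n} (G : Digraph n) {u v} → adj G u v ≡ true → u ≢ v
adj⇒≢ G {u} uv refl with trans (sym uv) (noLoops G u)
... | ()

hasIn hasOut : ∀ {n} → Digraph n → Fin n → Bool
hasIn  G v = does (any? λ u → adj G u v ≟ true)
hasOut G u = does (any? λ v → adj G u v ≟ true)

hasIn-intro : ∀ {n} (G : Digraph n) {u v} → adj G u v ≡ true → hasIn G v ≡ true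
hasIn-intro G {u} uv = dec-true (any? _) (u , uv)

hasOut-intro : ∀ {n} (G : Digraph n) {u v} → adj G u v ≡ true → hasOut G u ≡ true
hasOut-intro G {v = v} uv = dec-true (any? _) (v , uv)

hasIn-elim : ∀ {n} (G : Digraph n) {v} → hasIn G v ≡ true → ∃[ u ] adj G u v ≡ true
hasIn-elim G {v} h with any? (λ u → adj G u v ≟ true)
... | yes witness = witness

hasOut-elim : ∀ {n} (G : Digraph n) {u} → hasOut G u ≡ true → ∃[ v ] adj G u v ≡ true
hasOut-elim G {u} h with any? (λ v → adj G u v ≟ true)
... | yes witness = witness

⟦⟧≡0 : ∀ {b} → b ≢ true → ⟦ b ⟧ ≡ 0
⟦⟧≡0 b≢true = cong ⟦_⟧ (¬-not b≢true)

⟦⟧-≤-split : ∀ {b x y s} → (b ≡ true → s ≡ true ⊎ (x ≡ true × y ≡ true)) →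
             ⟦ b ⟧ ≤ ⟦ x ⟧ * ⟦ y ⟧ + ⟦ s ⟧ * ⟦ b ⟧
⟦⟧-≤-split {false} split = z≤n
⟦⟧-≤-split {true} {x} {y} split with split refl
... | inj₁ refl          = m≤n+m 1 (⟦ x ⟧ * ⟦ y ⟧)
... | inj₂ (refl , refl) = s≤s z≤n

⟦⟧*-≤ : ∀ {s d} → (s ≡ true → d ≤ 1) → ⟦ s ⟧ * d ≤ ⟦ s ⟧
⟦⟧*-≤ {false} d≤1 = z≤n
⟦⟧*-≤ {true} {d} d≤1 = ≤-trans (≤-reflexive (+-identityʳ d)) (d≤1 refl)

NoRainbowPath : ∀ {n} → Digraph n → Digraph n → Set
NoRainbowPath G H = ∀ {x y z} → adj G x y ≡ true → adj H y z ≡ true → x ≡ z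

NoRainbowPath-transpose : ∀ {n} {G H : Digraph n} →
  NoRainbowPath G H → NoRainbowPath (transpose H) (transpose G)
NoRainbowPath-transpose G→H xy yz = sym (G→H yz xy)

module _ {n} (G H : Digraph n) (G→H : NoRainbowPath G H) (H→G : NoRainbowPath H G) where

  edge-classified : ∀ {u v} → adj G u v ≡ true →
    (hasIn G ∩ hasOut H) v ≡ true ⊎ ((hasOut G ∖ hasIn H) u ≡ true × (hasIn G ∖ hasOut H) v ≡ true)
  edge-classified {u} {v} uv with hasOut H v in out-v | hasIn H u in in-u
  ... | true  | _     = inj₁ (cong₂ _∧_ (hasIn-intro G uv) refl)
  ... | false | false = inj₂ (cong₂ _∧_ (hasOut-intro G uv) refl , cong₂ _∧_ (hasIn-intro G uv) refl)
  ... | false | true  = contradiction (trans (sym out-v) (hasOut-intro H vu)) λ ()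
    where
    -- an H-edge w → u followed by u → v in G forces w = v
    vu : adj H v u ≡ true
    vu with hasIn-elim H in-u
    ... | w , wu = subst (λ x → adj H x u ≡ true) (H→G wu uv) wu

  in-degree≤1 : ∀ {v} → (hasIn G ∩ hasOut H) v ≡ true → ∑[ u < n ] ⟦ adj G u v ⟧ ≤ 1
  in-degree≤1 {v} sv with hasOut-elim H (∧-conicalʳ _ _ sv)
  ... | z , vz = ≤-trans (≤-reflexive (∑-supported-at _ z λ u u≢z → ⟦⟧≡0 λ uv → u≢z (G→H uv vz)))
                         (⟦⟧≤1 _)

  e≤∣out∖in∣*∣in∖out∣+∣in∩out∣ :
    e G ≤ ∣ hasOut G ∖ hasIn H ∣ * ∣ hasIn G ∖ hasOut H ∣ + ∣ hasIn G ∩ hasOut H ∣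
  e≤∣out∖in∣*∣in∖out∣+∣in∩out∣ = begin
    e G ≡⟨ e≡∑∑ G ⟩
    ∑[ u < n ] ∑[ v < n ] ⟦ adj G u v ⟧
      ≤⟨ ∑-mono-≤ (λ u → ∑-mono-≤ (λ v → ⟦⟧-≤-split (edge-classified {u} {v}))) ⟩
    ∑[ u < n ] ∑[ v < n ] (⟦ B u ⟧ * ⟦ A v ⟧ + ⟦ S v ⟧ * ⟦ adj G u v ⟧)
      ≡⟨ ∑∑-distrib-+ (λ u v → ⟦ B u ⟧ * ⟦ A v ⟧) (λ u v → ⟦ S v ⟧ * ⟦ adj G u v ⟧) ⟩
    ∑[ u < n ] ∑[ v < n ] (⟦ B u ⟧ * ⟦ A v ⟧) + ∑[ u < n ] ∑[ v < n ] (⟦ S v ⟧ * ⟦ adj G u v ⟧)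
      ≡⟨ cong₂ _+_ (∑∑-* (⟦_⟧ ∘ B) (⟦_⟧ ∘ A)) (∑-comm (λ u v → ⟦ S v ⟧ * ⟦ adj G u v ⟧)) ⟩
    ∣ B ∣ * ∣ A ∣ + ∑[ v < n ] ∑[ u < n ] (⟦ S v ⟧ * ⟦ adj G u v ⟧)
      ≡⟨ cong (∣ B ∣ * ∣ A ∣ +_)
              (sum-cong-≗ (λ v → sym (*-distribˡ-sum ⟦ S v ⟧ (λ u → ⟦ adj G u v ⟧)))) ⟩
    ∣ B ∣ * ∣ A ∣ + ∑[ v < n ] (⟦ S v ⟧ * ∑[ u < n ] ⟦ adj G u v ⟧)
      ≤⟨ +-monoʳ-≤ (∣ B ∣ * ∣ A ∣) (∑-mono-≤ (λ v → ⟦⟧*-≤ (in-degree≤1 {v}))) ⟩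
    ∣ B ∣ * ∣ A ∣ + ∣ S ∣ ∎
    where
    open ≤-Reasoning
    A B S : Fin n → Bool
    A = hasIn G ∖ hasOut H
    B = hasOut G ∖ hasIn H
    S = hasIn G ∩ hasOut H

4mn≤[m+n]² : ∀ m n → 4 * (m * n) ≤ (m + n) * (m + n)
4mn≤[m+n]² m n = [ bound , bound-swapped ]′ (≤-total m n)
  where
  expand : ∀ a d → 4 * (a * (a + d)) + d * d ≡ (a + (a + d)) * (a + (a + d))
  expand = solve-∀
  bound : ∀ {a b} → a ≤ b → 4 * (a * b) ≤ (a + b) * (a + b)
  bound {a} a≤b with m≤n⇒∃[o]m+o≡n a≤b
  ... | d , refl = subst (4 * (a * (a + d)) ≤_) (expand a d) (m≤m+n _ (d * d))
  bound-swapped : n ≤ m → 4 * (m * n) ≤ (m + n) * (m + n)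
  bound-swapped n≤m =
    subst₂ _≤_ (cong (4 *_) (*-comm n m)) (cong (λ k → k * k) (+-comm n m)) (bound n≤m)

m*m≤n*n⇒m≤n : ∀ {m n} → m * m ≤ n * n → m ≤ n
m*m≤n*n⇒m≤n {m} {n} m²≤n² with m ≤? n
... | yes m≤n = m≤n
... | no  m≰n = contradiction m²≤n² (<⇒≱ (*-mono-< (≰⇒> m≰n) (≰⇒> m≰n)))

4[ba⊓ht]≤[a+t][b+h] : ∀ a t b h → 4 * ((b * a) ⊓ (h * t)) ≤ (a + t) * (b + h)
4[ba⊓ht]≤[a+t][b+h] a t b h = m*m≤n*n⇒m≤n (begin
  4 * x * (4 * x)
    ≤⟨ *-mono-≤ (*-monoʳ-≤ 4 (m⊓n≤m (b * a) (h * t))) (*-monoʳ-≤ 4 (m⊓n≤n (b * a) (h * t))) ⟩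
  4 * (b * a) * (4 * (h * t))              ≡⟨ regroupˡ a t b h ⟩
  4 * (a * t) * (4 * (b * h))              ≤⟨ *-mono-≤ (4mn≤[m+n]² a t) (4mn≤[m+n]² b h) ⟩
  (a + t) * (a + t) * ((b + h) * (b + h))  ≡⟨ regroupʳ a t b h ⟩
  (a + t) * (b + h) * ((a + t) * (b + h))  ∎)
  where
  open ≤-Reasoning
  x = (b * a) ⊓ (h * t)
  regroupˡ : ∀ a t b h → 4 * (b * a) * (4 * (h * t)) ≡ 4 * (a * t) * (4 * (b * h))
  regroupˡ = solve-∀
  regroupʳ : ∀ a t b h →
    (a + t) * (a + t) * ((b + h) * (b + h)) ≡ (a + t) * (b + h) * ((a + t) * (b + h))
  regroupʳ = solve-∀

m*4≤n*n⇒m≤quarterSq : ∀ {m n} → m * 4 ≤ n * n → m ≤ quarterSq n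
m*4≤n*n⇒m≤quarterSq {m} {n} le = subst (_≤ n * n / 4) (m*n/n≡m m 4) (/-monoˡ-≤ 4 le)

4x≤pr⇒x+s≤quarterSq : ∀ {x s p r n} → 4 * x ≤ p * r → p + s ≤ n → r ≤ n → 4 ≤ n →
  x + s ≤ quarterSq n
4x≤pr⇒x+s≤quarterSq {x} {s} {p} {r} {n} 4x≤pr p+s≤n r≤n 4≤n = m*4≤n*n⇒m≤quarterSq {n = n} (begin
  (x + s) * 4    ≡⟨ *-distribʳ-+ 4 x s ⟩
  x * 4 + s * 4  ≡⟨ cong₂ _+_ (*-comm x 4) (*-comm s 4) ⟩
  4 * x + 4 * s  ≤⟨ +-mono-≤ (≤-trans 4x≤pr (*-monoʳ-≤ p r≤n)) (*-monoˡ-≤ s 4≤n) ⟩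
  p * n + n * s  ≡⟨ cong (p * n +_) (*-comm n s) ⟩
  p * n + s * n  ≡⟨ *-distribʳ-+ n p s ⟨
  (p + s) * n    ≤⟨ *-monoˡ-≤ n p+s≤n ⟩
  n * n          ∎)
  where open ≤-Reasoning

smaller-product+s≤quarterSq : ∀ a t s b h {n} → a + t + s ≤ n → b + h ≤ n → 4 ≤ n →
  b * a + s ≤ quarterSq n ⊎ h * t + s ≤ quarterSq n
smaller-product+s≤quarterSq a t s b h {n} a+t+s≤n b+h≤n 4≤n =
  Sum.map min≡⇒ min≡⇒ (⊓-sel (b * a) (h * t))
  where
  min+s≤quarterSq : (b * a) ⊓ (h * t) + s ≤ quarterSq n
  min+s≤quarterSq = 4x≤pr⇒x+s≤quarterSq {p = a + t} (4[ba⊓ht]≤[a+t][b+h] a t b h) a+t+s≤n b+h≤n 4≤n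
  min≡⇒ : ∀ {m} → (b * a) ⊓ (h * t) ≡ m → m + s ≤ quarterSq n
  min≡⇒ min≡m = subst (λ m → m + s ≤ quarterSq n) min≡m min+s≤quarterSq

two-colour-bound : ∀ {n} {G H : Digraph n} → NoRainbowPath G H → NoRainbowPath H G → 4 ≤ n →
  e G ≤ quarterSq n ⊎ e H ≤ quarterSq n
two-colour-bound {n} {G} {H} G→H H→G 4≤n =
  Sum.map (≤-trans e-G≤) (≤-trans e-H≤) (smaller-product+s≤quarterSq a t s b h a+t+s≤n b+h≤n 4≤n)
  where
  a t s b h : ℕ
  a = ∣ hasIn G ∖ hasOut H ∣
  t = ∣ hasOut H ∖ hasIn G ∣
  s = ∣ hasIn G ∩ hasOut H ∣
  b = ∣ hasOut G ∖ hasIn H ∣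
  h = ∣ hasIn H ∖ hasOut G ∣
  e-G≤ : e G ≤ b * a + s
  e-G≤ = e≤∣out∖in∣*∣in∖out∣+∣in∩out∣ G H G→H H→G
  e-H≤ : e H ≤ h * t + s
  e-H≤ = subst₂ _≤_ (e-transpose H) (cong (h * t +_) (∣∩∣-comm (hasOut H) (hasIn G)))
    (e≤∣out∖in∣*∣in∖out∣+∣in∩out∣ (transpose H) (transpose G)
      (NoRainbowPath-transpose {G = G} {H = H} G→H) (NoRainbowPath-transpose {G = H} {H = G} H→G))
  a+t+s≤n : a + t + s ≤ n
  a+t+s≤n = ∣∖∣+∣∖∣+∣∩∣≤n (hasIn G) (hasOut H)
  b+h≤n : b + h ≤ n
  b+h≤n = ≤-trans (m≤m+n (b + h) _) (∣∖∣+∣∖∣+∣∩∣≤n (hasOut G) (hasIn H))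

bipartite : ∀ {n} → (Fin n → Bool) → Digraph n
bipartite L = record { adj = λ u v → L u ∧ not (L v) ; noLoops = λ v → ∧-inverseʳ (L v) }

e-bipartite : ∀ {n} (L : Fin n → Bool) → e (bipartite L) ≡ ∣ L ∣ * ∣ not ∘ L ∣
e-bipartite L = trans (e≡∑∑ (bipartite L))
  (trans (sum-cong-≗ (λ u → sum-cong-≗ (λ v → ⟦∧⟧ (L u) (not (L v)))))
         (∑∑-* (⟦_⟧ ∘ L) (⟦_⟧ ∘ not ∘ L)))

∣toℕ<ᵇ∣≡ : ∀ {n h} → h ≤ n → ∣ (λ (u : Fin n) → toℕ u <ᵇ h) ∣ ≡ h
∣toℕ<ᵇ∣≡ {zero}          z≤n       = refl
∣toℕ<ᵇ∣≡ {suc n} {zero}  z≤n       = ∣toℕ<ᵇ∣≡ {n} z≤n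
∣toℕ<ᵇ∣≡ {suc n} {suc h} (s≤s h≤n) = cong suc (∣toℕ<ᵇ∣≡ h≤n)

⌊n/2⌋*⌈n/2⌉≡quarterSq : ∀ n → ⌊ n /2⌋ * ⌈ n /2⌉ ≡ quarterSq n
⌊n/2⌋*⌈n/2⌉≡quarterSq zero          = refl
⌊n/2⌋*⌈n/2⌉≡quarterSq (suc zero)    = refl
⌊n/2⌋*⌈n/2⌉≡quarterSq (suc (suc n)) = begin
  suc ⌊ n /2⌋ * suc ⌈ n /2⌉                   ≡⟨ expandˡ ⌊ n /2⌋ ⌈ n /2⌉ ⟩
  ⌊ n /2⌋ * ⌈ n /2⌉ + suc (⌊ n /2⌋ + ⌈ n /2⌉)
    ≡⟨ cong₂ (λ q k → q + suc k) (⌊n/2⌋*⌈n/2⌉≡quarterSq n) (⌊n/2⌋+⌈n/2⌉≡n n) ⟩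
  n * n / 4 + suc n                           ≡⟨ cong (n * n / 4 +_) (m*n/n≡m (suc n) 4) ⟨
  n * n / 4 + suc n * 4 / 4                   ≡⟨ +-distrib-/-∣ʳ (n * n) (divides-refl (suc n)) ⟨
  (n * n + suc n * 4) / 4                     ≡⟨ cong (_/ 4) (expandʳ n) ⟩
  suc (suc n) * suc (suc n) / 4               ∎
  where
  open ≡-Reasoning
  expandˡ : ∀ a b → suc a * suc b ≡ a * b + suc (a + b)
  expandˡ = solve-∀
  expandʳ : ∀ n → n * n + suc n * 4 ≡ suc (suc n) * suc (suc n)
  expandʳ = solve-∀

lowerHalf : ∀ n → Fin n → Bool
lowerHalf n u = toℕ u <ᵇ ⌊ n /2⌋

halves : ∀ n → Digraph n
halves n = bipartite (lowerHalf n)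

e-halves : ∀ n → e (halves n) ≡ quarterSq n
e-halves n = begin
  e (halves n)           ≡⟨ e-bipartite L ⟩
  ∣ L ∣ * ∣ not ∘ L ∣    ≡⟨ cong₂ _*_ ∣L∣≡ ∣not∘L∣≡ ⟩
  ⌊ n /2⌋ * ⌈ n /2⌉      ≡⟨ ⌊n/2⌋*⌈n/2⌉≡quarterSq n ⟩
  quarterSq n            ∎
  where
  open ≡-Reasoning
  L = lowerHalf n
  ∣L∣≡ : ∣ L ∣ ≡ ⌊ n /2⌋
  ∣L∣≡ = ∣toℕ<ᵇ∣≡ (⌊n/2⌋≤n n)
  ∣not∘L∣≡ : ∣ not ∘ L ∣ ≡ ⌈ n /2⌉
  ∣not∘L∣≡ = +-cancelˡ-≡ ⌊ n /2⌋ _ _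
    (trans (cong (_+ ∣ not ∘ L ∣) (sym ∣L∣≡)) (trans (∣p∣+∣not∘p∣≡n L) (sym (⌊n/2⌋+⌈n/2⌉≡n n))))

no-rainbow⇒NoRainbowPath : ∀ {c n} (G : Collection c n) → ¬ HasRainbowS11 G →
  ∀ {i j} → i ≢ j → NoRainbowPath (G i) (G j)
no-rainbow⇒NoRainbowPath G no-rainbow {i} {j} i≢j {x} {y} {z} xy yz with x ≟ᶠ z
... | yes x≡z = x≡z
... | no  x≢z = contradiction (x , y , z , i , j , adj⇒≢ (G i) xy , adj⇒≢ (G j) yz , x≢z , i≢j , xy , yz)
                              no-rainbow

constant-bipartite-no-rainbow : ∀ {c n} (L : Fin n → Bool) → ¬ HasRainbowS11 {c} (λ _ → bipartite L)
constant-bipartite-no-rainbow L (x , y , _ , _ , _ , _ , _ , _ , _ , xy , yz) =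
  contradiction (trans (sym (cong not (∧-conicalˡ (L y) _ yz))) (∧-conicalʳ (L x) _ xy)) λ ()

theorem6 : (c n : ℕ) → 2 ≤ c → 4 ≤ n →
    ((G : Collection c n) → ¬ HasRainbowS11 G → ∃[ i ] (e (G i) ≤ quarterSq n))
    × (Σ[ G ∈ Collection c n ] (¬ HasRainbowS11 G
    × ((i : Fin c) → quarterSq n ≤ e (G i))
    × ∃[ i ] (e (G i) ≡ quarterSq n)))
theorem6 zero          n ()                _
theorem6 (suc zero)    n (s≤s ())          _
theorem6 (suc (suc c)) n (s≤s (s≤s z≤n)) 4≤n = bound , extremal
  where
  bound : (G : Collection (suc (suc c)) n) → ¬ HasRainbowS11 G → ∃[ i ] (e (G i) ≤ quarterSq n)
  bound G no-rainbow =
    [ (zero ,_) , (suc zero ,_) ]′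
      (two-colour-bound {G = G zero} {H = G (suc zero)}
        (no-rainbow⇒NoRainbowPath G no-rainbow {zero} {suc zero} λ ())
        (no-rainbow⇒NoRainbowPath G no-rainbow {suc zero} {zero} λ ()) 4≤n)
  extremal : Σ[ G ∈ Collection (suc (suc c)) n ] (¬ HasRainbowS11 G
    × ((i : Fin (suc (suc c))) → quarterSq n ≤ e (G i)) × ∃[ i ] (e (G i) ≡ quarterSq n))
  extremal = (λ _ → halves n) , constant-bipartite-no-rainbow (lowerHalf n)
           , (λ _ → ≤-reflexive (sym (e-halves n))) , (zero , e-halves n)
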